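{- Let $(X,R)$ be the 3-cyclic forcing network and let $G$ be a connected $X$-colored graph. Let $i\ge 0$ and let $\ell_i(G)$ be the coloring after the $i$-th propagating forcing step of the process with propagation. (1) If the colors appearing in $\ell_i(G)$ are exactly $1$ and $2$, then $\epsilon(\ell_0(G))$ has all vertices colored $1$. (2) If the colors appearing in $\ell_i(G)$ are exactly $2$ and $3$, then $\epsilon(\ell_0(G))$ has all vertices colored $2$. (3) If the colors appearing in $\ell_i(G)$ are exactly $1$ and $3$, then $\epsilon(\ell_0(G))$ has all vertices colored $3$.
   Context: The 3-cyclic forcing network is $X=\{1,2,3\}$ with the ordered list of rules $R=(1\to 2,\,2\to 3,\,3\to 1)$. An $X$-colored graph is a finite simple graph with each vertex colored by an element of $X$. Applying a rule $a\to b$ in a forcing step means simultaneously recoloring with $a$ every vertex of color $b$ having a neighbor of color $a$; a propagating forcing step with rule $a\to b$ repeats forcing steps with that rule until no vertex of color $b$ has a neighbor of color $a$. The process with propagation applies propagating forcing steps with the rules in cyclic order $1\to2,2\to3,3\to1,1\to2,\dots$ until no rule can be applied; $\ell_0(G)$ is the initial coloring, $\ell_i(G)$ the coloring after the $i$-th propagating forcing step, and $\epsilon(\ell_0(G))$ the final coloring (end state). -}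

module Defs where

open import Data.Nat using (ℕ; zero; suc)
open import Data.Fin using (Fin)
open import Data.Fin.Properties using (any?)
open import Data.Product using (Σ; ∃; _×_; _,_)
open import Data.Sum using (_⊎_)
open import Relation.Nullary using (Dec; yes; no; ¬_)
open import Relation.Nullary.Decidable using (_×-dec_)
open import Relation.Binary.PropositionalEquality using (_≡_; refl)
open import Relation.Binary.Construct.Closure.ReflexiveTransitive using (Star)
open import Function using (_∘_)

data Color : Set where
  c1 c2 c3 : Color

_≟c_ : (x y : Color) → Dec (x ≡ y)
c1 ≟c c1 = yes refl
c1 ≟c c2 = no (λ ())
c1 ≟c c3 = no (λ ())
c2 ≟c c1 = no (λ ())
c2 ≟c c2 = yes refl
c2 ≟c c3 = no (λ ())
c3 ≟c c1 = no (λ ())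
c3 ≟c c2 = no (λ ())
c3 ≟c c3 = yes refl

record SimpleGraph (n : ℕ) : Set₁ where
  field
    Adj    : Fin n → Fin n → Set
    adj?   : (u v : Fin n) → Dec (Adj u v)
    sym    : ∀ {u v} → Adj u v → Adj v u
    irrefl : ∀ {u} → ¬ Adj u u
open SimpleGraph public

Connected : ∀ {n} → SimpleGraph n → Set
Connected G = ∀ u v → Star (Adj G) u v

Coloring : ℕ → Set
Coloring n = Fin n → Color

record Rule : Set where
  constructor _⇒_
  field
    src tgt : Color
open Rule public

R₀ R₁ R₂ : Rule
R₀ = c1 ⇒ c2
R₁ = c2 ⇒ c3
R₂ = c3 ⇒ c1

-- Rule used by the (i+1)-th propagating forcing step: R[i mod 3].
ruleAt : ℕ → Rule
ruleAt zero = R₀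
ruleAt (suc zero) = R₁
ruleAt (suc (suc zero)) = R₂
ruleAt (suc (suc (suc i))) = ruleAt i

hasNbr : ∀ {n} (G : SimpleGraph n) (ℓ : Coloring n) (a : Color) (v : Fin n) →
         Dec (∃ λ u → Adj G u v × ℓ u ≡ a)
hasNbr G ℓ a v = any? (λ u → adj? G u v ×-dec (ℓ u ≟c a))

forceStep : ∀ {n} → SimpleGraph n → Rule → Coloring n → Coloring n
forceStep G (a ⇒ b) ℓ v with ℓ v ≟c b | hasNbr G ℓ a v
... | yes _ | yes _ = a
... | yes _ | no  _ = ℓ v
... | no  _ | _     = ℓ v

-- Propagating forcing step: repeat forcing steps until none changes the
-- coloring.  Every non-trivial forcing step strictly decreases the number
-- of vertices of color b, so after n steps (n = number of vertices) the
-- coloring is stable; iterating exactly n times is thus the propagating step.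
-- k-fold iteration of a map.
iter : ∀ {A : Set} → (A → A) → ℕ → A → A
iter f zero x = x
iter f (suc k) x = f (iter f k x)

propStep : ∀ {n} → SimpleGraph n → Rule → Coloring n → Coloring n
propStep {n} G r ℓ = iter (forceStep G r) n ℓ

ℓ : ∀ {n} → SimpleGraph n → Coloring n → ℕ → Coloring n
ℓ G c zero = c
ℓ G c (suc i) = propStep G (ruleAt i) (ℓ G c i)

Applicable : ∀ {n} → SimpleGraph n → Coloring n → Rule → Set
Applicable {n} G c (a ⇒ b) = ∃ λ v → c v ≡ b × ∃ λ u → Adj G u v × c u ≡ a

Stopped : ∀ {n} → SimpleGraph n → Coloring n → Set
Stopped G c = ¬ Applicable G c R₀ × ¬ Applicable G c R₁ × ¬ Applicable G c R₂

-- "ε(ℓ₀(G)) has all vertices colored x": the process stops (at some step j)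
-- and the final coloring is constantly x.
EndStateAll : ∀ {n} → SimpleGraph n → Coloring n → Color → Set
EndStateAll {n} G c x =
  ∃ λ j → Stopped G (ℓ G c j) × (∀ (v : Fin n) → ℓ G c j v ≡ x)

ColorsExactly : ∀ {n} → Coloring n → Color → Color → Set
ColorsExactly {n} c x y =
  (∃ λ v → c v ≡ x) × (∃ λ v → c v ≡ y) × (∀ (v : Fin n) → c v ≡ x ⊎ c v ≡ y)

-- During a propagating step a ⇒ b on a connected graph coloured by a and b only, the set
-- of a-vertices grows monotonically; counting shows it stops growing within n forcing
-- steps, and once stable it is closed under adjacency, so it contains every vertex.
-- If the colours of ℓ_i are a and next a, every rule x ⇒ next x with x ≠ a misses one of
-- its two colours and leaves the colouring unchanged, so within three steps the rule
-- a ⇒ next a is reached, floods the graph with a, and a constant colouring is stopped.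
module Submission where

open import Defs
open import Data.Nat using (ℕ; zero; suc; _+_; _≤_; _<_; _≤′_; ≤′-refl; ≤′-step; z≤n; s≤s)
open import Data.Nat.Properties using (≤-refl; ≤-trans; m≤n⇒m≤1+n; ≤-<-trans; <⇒≱; ≤⇒≤′; +-suc)
open import Data.Fin using (Fin; zero; suc)
open import Data.Fin.Properties using (any?)
open import Data.Product using (_×_; _,_; ∃; ∃-syntax)
open import Data.Sum using (_⊎_; inj₁; inj₂) renaming (swap to ⊎-swap)
open import Function using (_∘_; id)
open import Level using (Level)
open import Relation.Nullary using (yes; no; ¬_; contradiction)
open import Relation.Nullary.Decidable using (_×-dec_; ¬?; decidable-stable)
open import Relation.Unary using (Pred; Decidable; _⊆_)
open import Relation.Binary.PropositionalEquality
  using (_≡_; _≢_; _≗_; refl; trans; subst; cong) renaming (sym to ≡-sym)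
open import Relation.Binary.Construct.Closure.ReflexiveTransitive using (Star; ε; _◅_)

private
  variable
    p : Level
    n : ℕ

count : ∀ {n} {P : Pred (Fin n) p} → Decidable P → ℕ
count {n = zero}  P? = 0
count {n = suc n} P? with P? zero
... | yes _ = suc (count (P? ∘ suc))
... | no  _ = count (P? ∘ suc)

count≤n : ∀ {n} {P : Pred (Fin n) p} (P? : Decidable P) → count P? ≤ n
count≤n {n = zero}  P? = z≤n
count≤n {n = suc n} P? with P? zero
... | yes _ = s≤s (count≤n (P? ∘ suc))
... | no  _ = m≤n⇒m≤1+n (count≤n (P? ∘ suc))

count-mono : ∀ {n} {P Q : Pred (Fin n) p} (P? : Decidable P) (Q? : Decidable Q) →
             P ⊆ Q → count P? ≤ count Q?
count-mono {n = zero}  P? Q? P⊆Q = z≤n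
count-mono {n = suc n} P? Q? P⊆Q with P? zero | Q? zero
... | yes _  | yes _  = s≤s (count-mono (P? ∘ suc) (Q? ∘ suc) P⊆Q)
... | yes P0 | no ¬Q0 = contradiction (P⊆Q P0) ¬Q0
... | no _   | yes _  = m≤n⇒m≤1+n (count-mono (P? ∘ suc) (Q? ∘ suc) P⊆Q)
... | no _   | no _   = count-mono (P? ∘ suc) (Q? ∘ suc) P⊆Q

count-strict : ∀ {n} {P Q : Pred (Fin n) p} (P? : Decidable P) (Q? : Decidable Q) → P ⊆ Q →
               ∀ v → Q v → ¬ P v → count P? < count Q?
count-strict P? Q? P⊆Q zero Q0 ¬P0 with P? zero | Q? zero
... | yes P0 | _      = contradiction P0 ¬P0
... | no _   | no ¬Q0 = contradiction Q0 ¬Q0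
... | no _   | yes _  = s≤s (count-mono (P? ∘ suc) (Q? ∘ suc) P⊆Q)
count-strict P? Q? P⊆Q (suc v) Qv ¬Pv with P? zero | Q? zero
... | yes _  | yes _  = s≤s (count-strict (P? ∘ suc) (Q? ∘ suc) P⊆Q v Qv ¬Pv)
... | yes P0 | no ¬Q0 = contradiction (P⊆Q P0) ¬Q0
... | no _   | yes _  = m≤n⇒m≤1+n (count-strict (P? ∘ suc) (Q? ∘ suc) P⊆Q v Qv ¬Pv)
... | no _   | no _   = count-strict (P? ∘ suc) (Q? ∘ suc) P⊆Q v Qv ¬Pv

module _ (P : ℕ → Pred (Fin n) p) (inflationary : ∀ k → P k ⊆ P (suc k)) where

  ascending-mono : ∀ {j k} → j ≤′ k → P j ⊆ P k
  ascending-mono ≤′-refl        = id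
  ascending-mono (≤′-step j≤′k) = inflationary _ ∘ ascending-mono j≤′k

  module _ (P? : ∀ k → Decidable (P k)) where

    stable-or-grows : ∀ k → P (suc k) ⊆ P k ⊎ count (P? k) < count (P? (suc k))
    stable-or-grows k with any? (λ v → P? (suc k) v ×-dec ¬? (P? k v))
    ... | yes (v , Pv , ¬Pv) = inj₂ (count-strict (P? k) (P? (suc k)) (inflationary k) v Pv ¬Pv)
    ... | no ¬new            = inj₁ λ {v} Pv → decidable-stable (P? k v) (λ ¬Pv → ¬new (v , Pv , ¬Pv))

    stable-or-large : ∀ k → (∃[ j ] j ≤ k × P (suc j) ⊆ P j) ⊎ k < count (P? (suc k))
    stable-or-large zero with stable-or-grows zero
    ... | inj₁ stable = inj₁ (zero , z≤n , stable)
    ... | inj₂ grows  = inj₂ (≤-<-trans z≤n grows)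
    stable-or-large (suc k) with stable-or-large k | stable-or-grows (suc k)
    ... | inj₁ (j , j≤k , stable) | _            = inj₁ (j , m≤n⇒m≤1+n j≤k , stable)
    ... | inj₂ _                  | inj₁ stable  = inj₁ (suc k , ≤-refl , stable)
    ... | inj₂ large              | inj₂ grows   = inj₂ (≤-trans (s≤s large) grows)

    ascending-chain-stabilises : ∃[ k ] k ≤ n × P (suc k) ⊆ P k
    ascending-chain-stabilises with stable-or-large n
    ... | inj₁ stable = stable
    ... | inj₂ large  = contradiction (count≤n (P? (suc n))) (<⇒≱ large)

module _ {G : SimpleGraph n} {P : Pred (Fin n) p} (closed : ∀ {u v} → Adj G u v → P u → P v) where

  walk-preserves : ∀ {u v} → Star (Adj G) u v → P u → P v
  walk-preserves ε           = id
  walk-preserves (uw ◅ walk) = walk-preserves walk ∘ closed uw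

  connected-closed-everywhere : Connected G → ∀ {u} → P u → ∀ v → P v
  connected-closed-everywhere connected {u} Pu v = walk-preserves (connected u v) Pu

module _ {G : SimpleGraph n} {a b : Color} where

  forceStep-keeps-src : ∀ d v → d v ≡ a → forceStep G (a ⇒ b) d v ≡ a
  forceStep-keeps-src d v dv with d v ≟c b | hasNbr G d a v
  ... | yes _ | yes _ = refl
  ... | yes _ | no  _ = dv
  ... | no  _ | _     = dv

  forceStep-src-or-same : ∀ d v → forceStep G (a ⇒ b) d v ≡ a ⊎ forceStep G (a ⇒ b) d v ≡ d v
  forceStep-src-or-same d v with d v ≟c b | hasNbr G d a v
  ... | yes _ | yes _ = inj₁ refl
  ... | yes _ | no  _ = inj₂ refl
  ... | no  _ | _     = inj₂ refl

  forceStep-forces : ∀ d {u v} → Adj G u v → d u ≡ a → d v ≡ b → forceStep G (a ⇒ b) d v ≡ a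
  forceStep-forces d {u} {v} uv du dv with d v ≟c b | hasNbr G d a v
  ... | yes _  | yes _  = refl
  ... | yes _  | no ¬nb = contradiction (u , uv , du) ¬nb
  ... | no ¬dv | _      = contradiction dv ¬dv

  forceStep-inapplicable : ∀ d → ¬ Applicable G d (a ⇒ b) → forceStep G (a ⇒ b) d ≗ d
  forceStep-inapplicable d ¬app v with d v ≟c b | hasNbr G d a v
  ... | yes dv | yes nb = contradiction (v , dv , nb) ¬app
  ... | yes _  | no  _  = refl
  ... | no  _  | _      = refl

  Applicable-resp-≗ : ∀ {d d′} → d ≗ d′ → Applicable G d (a ⇒ b) → Applicable G d′ (a ⇒ b)
  Applicable-resp-≗ d≗d′ (v , dv , u , uv , du) =
    v , trans (≡-sym (d≗d′ v)) dv , u , uv , trans (≡-sym (d≗d′ u)) du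

  iter-forceStep-inapplicable : ∀ d → ¬ Applicable G d (a ⇒ b) → ∀ k → iter (forceStep G (a ⇒ b)) k d ≗ d
  iter-forceStep-inapplicable d ¬app zero    v = refl
  iter-forceStep-inapplicable d ¬app (suc k) v =
    trans (forceStep-inapplicable _ (¬app ∘ Applicable-resp-≗ dₖ≗d) v) (dₖ≗d v)
    where
    dₖ≗d : iter (forceStep G (a ⇒ b)) k d ≗ d
    dₖ≗d = iter-forceStep-inapplicable d ¬app k

  propStep-inapplicable : ∀ d → ¬ Applicable G d (a ⇒ b) → propStep G (a ⇒ b) d ≗ d
  propStep-inapplicable d ¬app = iter-forceStep-inapplicable d ¬app n

  propStep-floods : Connected G → ∀ d → (∀ v → d v ≡ a ⊎ d v ≡ b) → ∃ (λ u → d u ≡ a) →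
                    ∀ v → propStep G (a ⇒ b) d v ≡ a
  propStep-floods connected d two-colored (u , du) =
    flood (ascending-chain-stabilises Colored-a Colored-a-grows (λ k v → dₖ k v ≟c a))
    where
    dₖ : ℕ → Coloring n
    dₖ k = iter (forceStep G (a ⇒ b)) k d

    Colored-a : ℕ → Pred (Fin n) _
    Colored-a k v = dₖ k v ≡ a

    Colored-a-grows : ∀ k → Colored-a k ⊆ Colored-a (suc k)
    Colored-a-grows k = forceStep-keeps-src (dₖ k) _

    stays-two-colored : ∀ k v → dₖ k v ≡ a ⊎ dₖ k v ≡ b
    stays-two-colored zero    v = two-colored v
    stays-two-colored (suc k) v with forceStep-src-or-same (dₖ k) v
    ... | inj₁ forced = inj₁ forced
    ... | inj₂ same   = subst (λ x → x ≡ a ⊎ x ≡ b) (≡-sym same) (stays-two-colored k v)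

    flood : ∃[ k ] k ≤ n × Colored-a (suc k) ⊆ Colored-a k → ∀ v → Colored-a n v
    flood (k , k≤n , stable) v =
      ascending-mono Colored-a Colored-a-grows (≤⇒≤′ k≤n)
        (connected-closed-everywhere {G = G} {P = Colored-a k} closed connected
          (ascending-mono Colored-a Colored-a-grows (≤⇒≤′ (z≤n {k})) du) v)
      where
      closed : ∀ {x y} → Adj G x y → Colored-a k x → Colored-a k y
      closed {y = y} xy ax with stays-two-colored k y
      ... | inj₁ ay = ay
      ... | inj₂ by = stable (forceStep-forces (dₖ k) xy ax by)

next : Color → Color
next c1 = c2
next c2 = c3
next c3 = c1

next≢id : ∀ x → next x ≢ x
next≢id c1 ()
next≢id c2 ()
next≢id c3 ()

next²≢id : ∀ x → next (next x) ≢ x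
next²≢id c1 ()
next²≢id c2 ()
next²≢id c3 ()

consecutive-in-pair : ∀ {a x} → x ≡ a ⊎ x ≡ next a → next x ≡ a ⊎ next x ≡ next a → x ≡ a
consecutive-in-pair     (inj₁ x≡a)  _             = x≡a
consecutive-in-pair {a} (inj₂ refl) (inj₁ nnx≡a)  = contradiction nnx≡a (next²≢id a)
consecutive-in-pair {a} (inj₂ refl) (inj₂ nnx≡nx) = contradiction nnx≡nx (next≢id (next a))

ruleAt-consecutive : ∀ i → ruleAt i ≡ src (ruleAt i) ⇒ next (src (ruleAt i))
ruleAt-consecutive zero                = refl
ruleAt-consecutive (suc zero)          = refl
ruleAt-consecutive (suc (suc zero))    = refl
ruleAt-consecutive (suc (suc (suc i))) = ruleAt-consecutive i

src-ruleAt-suc : ∀ i → src (ruleAt (suc i)) ≡ next (src (ruleAt i))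
src-ruleAt-suc zero                = refl
src-ruleAt-suc (suc zero)          = refl
src-ruleAt-suc (suc (suc zero))    = refl
src-ruleAt-suc (suc (suc (suc i))) = src-ruleAt-suc i

src-ruleAt-+ : ∀ k i → src (ruleAt (k + i)) ≡ iter next k (src (ruleAt i))
src-ruleAt-+ zero    i = refl
src-ruleAt-+ (suc k) i = trans (src-ruleAt-suc (k + i)) (cong next (src-ruleAt-+ k i))

iter-next-reaches : ∀ x y → ∃[ k ] iter next k x ≡ y
iter-next-reaches c1 c1 = 0 , refl
iter-next-reaches c1 c2 = 1 , refl
iter-next-reaches c1 c3 = 2 , refl
iter-next-reaches c2 c1 = 2 , refl
iter-next-reaches c2 c2 = 0 , refl
iter-next-reaches c2 c3 = 1 , refl
iter-next-reaches c3 c1 = 1 , refl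
iter-next-reaches c3 c2 = 2 , refl
iter-next-reaches c3 c3 = 0 , refl

src-ruleAt-eventually : ∀ i a → ∃[ k ] src (ruleAt (k + i)) ≡ a
src-ruleAt-eventually i a with iter-next-reaches (src (ruleAt i)) a
... | k , reaches = k , trans (src-ruleAt-+ k i) reaches

ColorsExactly-swap : ∀ {d : Coloring n} {x y} → ColorsExactly d x y → ColorsExactly d y x
ColorsExactly-swap (some-x , some-y , only) = some-y , some-x , ⊎-swap ∘ only

ColorsExactly-resp-≗ : ∀ {d d′ : Coloring n} {x y} → d ≗ d′ → ColorsExactly d x y → ColorsExactly d′ x y
ColorsExactly-resp-≗ {x = x} {y} d≗d′ ((u , du) , (w , dw) , only) =
  (u , trans (≡-sym (d≗d′ u)) du) , (w , trans (≡-sym (d≗d′ w)) dw) ,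
  λ v → subst (λ z → z ≡ x ⊎ z ≡ y) (d≗d′ v) (only v)

module _ {G : SimpleGraph n} where

  constant-inapplicable : ∀ {d x a b} → (∀ v → d v ≡ x) → a ≢ b → ¬ Applicable G d (a ⇒ b)
  constant-inapplicable const a≢b (v , dv , u , _ , du) =
    a≢b (trans (≡-sym du) (trans (const u) (trans (≡-sym (const v)) dv)))

  constant-Stopped : ∀ {d x} → (∀ v → d v ≡ x) → Stopped G d
  constant-Stopped const = inapplicable c1 , inapplicable c2 , inapplicable c3
    where
    inapplicable : ∀ y → ¬ Applicable G _ (y ⇒ next y)
    inapplicable y = constant-inapplicable const (next≢id y ∘ ≡-sym)

  off-cycle-inapplicable : ∀ {d a x} → (∀ v → d v ≡ a ⊎ d v ≡ next a) → x ≢ a →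
                           ¬ Applicable G d (x ⇒ next x)
  off-cycle-inapplicable {a = a} only x≢a (v , dv , u , _ , du) =
    x≢a (consecutive-in-pair (subst (λ z → z ≡ a ⊎ z ≡ next a) du (only u))
                             (subst (λ z → z ≡ a ⊎ z ≡ next a) dv (only v)))

module _ {G : SimpleGraph n} (c : Coloring n) (connected : Connected G) (a : Color) where

  Consecutive : ℕ → Set
  Consecutive i = ColorsExactly (ℓ G c i) a (next a)

  floods-at : ∀ i → src (ruleAt i) ≡ a → Consecutive i → EndStateAll G c a
  floods-at i src≡a (some-a , _ , only) = suc i , constant-Stopped {G = G} flooded , flooded
    where
    rule≡ : ruleAt i ≡ a ⇒ next a
    rule≡ = trans (ruleAt-consecutive i) (cong (λ x → x ⇒ next x) src≡a)

    flooded : ∀ v → ℓ G c (suc i) v ≡ a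
    flooded = subst (λ r → ∀ v → propStep G r (ℓ G c i) v ≡ a) (≡-sym rule≡)
                    (propStep-floods connected (ℓ G c i) only some-a)

  inert-at : ∀ i → src (ruleAt i) ≢ a → Consecutive i → Consecutive (suc i)
  inert-at i src≢a consecutive@(_ , _ , only) = ColorsExactly-resp-≗ (≡-sym ∘ unchanged) consecutive
    where
    unchanged : ℓ G c (suc i) ≗ ℓ G c i
    unchanged = subst (λ r → propStep G r (ℓ G c i) ≗ ℓ G c i) (≡-sym (ruleAt-consecutive i))
                      (propStep-inapplicable (ℓ G c i) (off-cycle-inapplicable {G = G} only src≢a))

  floods-within : ∀ k i → src (ruleAt (k + i)) ≡ a → Consecutive i → EndStateAll G c a
  floods-within zero    i src≡a consecutive = floods-at i src≡a consecutive
  floods-within (suc k) i src≡a consecutive with src (ruleAt i) ≟c a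
  ... | yes srcᵢ≡a = floods-at i srcᵢ≡a consecutive
  ... | no  srcᵢ≢a =
    floods-within k (suc i) (subst (λ j → src (ruleAt j) ≡ a) (≡-sym (+-suc k i)) src≡a)
                  (inert-at i srcᵢ≢a consecutive)

  consecutive-colors-flood : ∀ i → Consecutive i → EndStateAll G c a
  consecutive-colors-flood i with src-ruleAt-eventually i a
  ... | k , src≡a = floods-within k i src≡a

lemma4p3 : ∀ {n} (G : SimpleGraph n) (c : Coloring n) → Connected G → (i : ℕ) →
    (ColorsExactly (ℓ G c i) c1 c2 → EndStateAll G c c1) ×
    (ColorsExactly (ℓ G c i) c2 c3 → EndStateAll G c c2) ×
    (ColorsExactly (ℓ G c i) c1 c3 → EndStateAll G c c3)
lemma4p3 G c connected i =
  consecutive-colors-flood c connected c1 i ,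
  consecutive-colors-flood c connected c2 i ,
  consecutive-colors-flood c connected c3 i ∘ ColorsExactly-swap
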